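{- Let $D_n$ be the dihedral group of order $2n$. Then: (i) if $n=p^r$ for some prime $p$, the difference graph $D(D_n)$ is the empty graph; (ii) if $n$ is not a prime power, $D(D_n)$ is a connected graph.
   Context: For a group $G$, the power graph $\mathsf{Pow}(G)$ has vertex set $G$, with distinct $a,b$ adjacent iff $a\in\langle b\rangle$ or $b\in\langle a\rangle$. The enhanced power graph $\mathsf{EPow}(G)$ has vertex set $G$, with distinct $a,b$ adjacent iff $\langle a,b\rangle$ is cyclic. The difference graph $D(G)$ is the graph $\mathsf{EPow}(G)-\mathsf{Pow}(G)$ with all isolated vertices removed; thus $x\sim y$ in $D(G)$ iff $\langle x,y\rangle$ is cyclic, $x\notin\langle y\rangle$ and $y\notin\langle x\rangle$. -}

module Defs where

open import Data.Nat using (ℕ; _+_; _∸_; _^_; NonZero)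
open import Data.Nat.DivMod using (_mod_)
open import Data.Nat.Primality using (Prime)
open import Data.Fin using (Fin; toℕ)
open import Data.Product using (Σ; ∃; _×_; _,_)
open import Data.Sum using (_⊎_)
open import Relation.Nullary using (¬_)
open import Relation.Binary.PropositionalEquality using (_≡_)
open import Relation.Binary.Construct.Closure.ReflexiveTransitive using (Star)

-- The dihedral group D_n of order 2n (n ≥ 1), presented as
--   D_n = ⟨ r, s | r^n = s^2 = 1, s r s = r^{-1} ⟩.
-- rot i  represents r^i,   ref i  represents r^i s   (i taken mod n).

data Dih (n : ℕ) : Set where
  rot : Fin n → Dih n
  ref : Fin n → Dih n

module _ {n : ℕ} .{{_ : NonZero n}} where

  _⊕_ : Fin n → Fin n → Fin n
  i ⊕ j = (toℕ i + toℕ j) mod n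

  _⊖_ : Fin n → Fin n → Fin n
  i ⊖ j = (toℕ i + (n ∸ toℕ j)) mod n

  -- multiplication:
  --   r^i   · r^j   = r^{i+j}
  --   r^i   · r^j s = r^{i+j} s
  --   r^i s · r^j   = r^{i-j} s
  --   r^i s · r^j s = r^{i-j}
  _·_ : Dih n → Dih n → Dih n
  rot i · rot j = rot (i ⊕ j)
  rot i · ref j = ref (i ⊕ j)
  ref i · rot j = ref (i ⊖ j)
  ref i · ref j = rot (i ⊖ j)

  e : Dih n
  e = rot (0 mod n)

  inv : Dih n → Dih n
  inv (rot i) = rot ((0 mod n) ⊖ i)
  inv (ref i) = ref i

  data ⟨_⟩ (S : Dih n → Set) : Dih n → Set where
    gen  : ∀ {x} → S x → ⟨ S ⟩ x
    unit : ⟨ S ⟩ e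
    mul  : ∀ {x y} → ⟨ S ⟩ x → ⟨ S ⟩ y → ⟨ S ⟩ (x · y)
    inverse : ∀ {x} → ⟨ S ⟩ x → ⟨ S ⟩ (inv x)

  ⟨_⟩₁ : Dih n → Dih n → Set
  ⟨ a ⟩₁ = ⟨ (λ x → x ≡ a) ⟩

  ⟨_,_⟩₂ : Dih n → Dih n → Dih n → Set
  ⟨ a , b ⟩₂ = ⟨ (λ x → x ≡ a ⊎ x ≡ b) ⟩

  IsCyclic : (Dih n → Set) → Set
  IsCyclic H = ∃ λ c → H c × (∀ x → H x → ⟨ c ⟩₁ x)

  -- adjacency in the difference graph D(D_n) = EPow − Pow
  DiffAdj : Dih n → Dih n → Set
  DiffAdj x y = IsCyclic ⟨ x , y ⟩₂ × ¬ ⟨ y ⟩₁ x × ¬ ⟨ x ⟩₁ y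

  -- vertices of D(D_n): the non-isolated vertices of EPow − Pow
  DiffVertex : Dih n → Set
  DiffVertex x = ∃ λ y → DiffAdj x y

  DiffEmpty : Set
  DiffEmpty = ∀ x → ¬ DiffVertex x

  DiffConnected : Set
  DiffConnected =
    (∃ λ x → DiffVertex x) ×
    (∀ x y → DiffVertex x → DiffVertex y → Star DiffAdj x y)

IsPrimePower : ℕ → Set
IsPrimePower n = ∃ λ p → ∃ λ r → Prime p × n ≡ p ^ r

module Submission where

-- A subgroup ⟨x, y⟩ containing a reflection s is cyclic only if it equals
-- ⟨s⟩ = {e, s}, so every edge of D(D_n) joins two rotations.  The rotation
-- r^a generates the same subgroup as r^δ with δ = gcd(a, n), hence r^a and r^b
-- are adjacent exactly when gcd(a, n) and gcd(b, n) are incomparable under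
-- divisibility.  The divisors of a prime power form a chain, which gives (i).
-- Otherwise take primes p ≠ q dividing n: r^p and r^q are adjacent, and a
-- vertex r^a with d = gcd(a, n) is adjacent to r^p or r^q unless p q ∣ d; in
-- that case it is adjacent to r^(t^(k+1)), where t is a prime factor of n/d
-- and t^k is the exact power of t dividing d, and t^(k+1) is incomparable with
-- p or with q.  So every vertex is joined to r^p, which gives (ii).

open import Defs
open import Data.Nat using (ℕ; NonZero)
open import Data.Product using (_×_)
open import Relation.Nullary using (¬_)

open import Data.Empty using (⊥-elim)
open import Data.Fin using (Fin; toℕ)
open import Data.Fin.Properties using (toℕ-injective; toℕ-fromℕ<; toℕ<n)
open import Data.List using ([]; _∷_; length)
open import Data.List.Relation.Unary.All using (All; []; _∷_)
open import Data.Nat.Base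
open import Data.Nat.Coprimality using (Coprime; coprime-divisor)
open import Data.Nat.Divisibility
open import Data.Nat.DivMod
open import Data.Nat.GCD
open import Data.Nat.Induction using (<-wellFounded)
open import Data.Nat.ListAction using (product)
open import Data.Nat.Primality
open import Data.Nat.Primality.Factorisation
open import Data.Nat.Properties
open import Data.Product using (∃; ∃₂; _,_)
open import Data.Sum using (_⊎_; inj₁; inj₂)
open import Function using (_∘_; it)
open import Induction.WellFounded using (Acc; acc)
open import Level using (0ℓ)
open import Relation.Binary.Construct.Closure.ReflexiveTransitive
  using (Star; ε; _◅_; _◅◅_; gmap; reverse)
open import Relation.Binary.PropositionalEquality
open import Relation.Nullary using (yes; no)
open import Relation.Unary using (Pred; _⊆_)

-- Prime divisors and prime powers

prime⇒≢1 : ∀ {p} → Prime p → p ≢ 1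
prime⇒≢1 p-prime = nonTrivial⇒≢1 {{prime⇒nonTrivial p-prime}}

prime∣prime⇒≡ : ∀ {p q} → Prime p → Prime q → p ∣ q → p ≡ q
prime∣prime⇒≡ p-prime q-prime p∣q with prime⇒irreducible q-prime p∣q
... | inj₁ p≡1 = ⊥-elim (prime⇒≢1 p-prime p≡1)
... | inj₂ p≡q = p≡q

prime∣^⇒≡ : ∀ {p q} → Prime p → Prime q → ∀ k → p ∣ q ^ k → p ≡ q
prime∣^⇒≡ p-prime q-prime zero p∣1 = ⊥-elim (prime⇒≢1 p-prime (∣1⇒≡1 p∣1))
prime∣^⇒≡ {q = q} p-prime q-prime (suc k) p∣q^[1+k]
  with euclidsLemma q (q ^ k) p-prime p∣q^[1+k]
... | inj₁ p∣q   = prime∣prime⇒≡ p-prime q-prime p∣q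
... | inj₂ p∣q^k = prime∣^⇒≡ p-prime q-prime k p∣q^k

^-monoʳ-∣ : ∀ p {j k} → j ≤ k → p ^ j ∣ p ^ k
^-monoʳ-∣ p {j} {k} j≤k = subst (p ^ j ∣_) p^j*p^[k∸j]≡p^k (m∣m*n (p ^ (k ∸ j)))
  where
  p^j*p^[k∸j]≡p^k : p ^ j * p ^ (k ∸ j) ≡ p ^ k
  p^j*p^[k∸j]≡p^k = trans (sym (^-distribˡ-+-* p j (k ∸ j))) (cong (p ^_) (m+[n∸m]≡n j≤k))

∣p^r⇒≡p^k : ∀ {p d} → Prime p → ∀ r → d ∣ p ^ r → ∃ λ k → d ≡ p ^ k
∣p^r⇒≡p^k p-prime zero d∣1 = 0 , ∣1⇒≡1 d∣1
∣p^r⇒≡p^k {p} {d} p-prime (suc r) d∣p^[1+r] with p ∣? d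
... | yes (divides d′ refl) =
  let d′∣p^r = *-cancelʳ-∣ p {{prime⇒nonZero p-prime}}
                 (subst (d′ * p ∣_) (*-comm p (p ^ r)) d∣p^[1+r])
      k , d′≡p^k = ∣p^r⇒≡p^k p-prime r d′∣p^r
  in suc k , trans (*-comm d′ p) (cong (p *_) d′≡p^k)
... | no p∤d = ∣p^r⇒≡p^k p-prime r (coprime-divisor d⊥p d∣p^[1+r])
  where
  d⊥p : Coprime d p
  d⊥p (i∣d , i∣p) with prime⇒irreducible p-prime i∣p
  ... | inj₁ i≡1  = i≡1
  ... | inj₂ refl = ⊥-elim (p∤d i∣d)

∃prime∣ : ∀ m .{{_ : NonZero m}} → m ≢ 1 → ∃ λ t → Prime t × t ∣ m
∃prime∣ m m≢1 with factorise m
... | record { factors = [] ; isFactorisation = m≡1 } = ⊥-elim (m≢1 m≡1)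
... | record { factors = t ∷ ts ; isFactorisation = m≡t*ts
             ; factorsPrime = t-prime ∷ _ } =
  t , t-prime , subst (t ∣_) (sym m≡t*ts) (m∣m*n (product ts))

product≡p^length⊎∃prime≢p : ∀ p {as} → All Prime as →
  product as ≡ p ^ length as ⊎ ∃ λ q → Prime q × q ∣ product as × q ≢ p
product≡p^length⊎∃prime≢p p [] = inj₁ refl
product≡p^length⊎∃prime≢p p {a ∷ as} (a-prime ∷ as-prime) with a ≟ p
... | no a≢p = inj₂ (a , a-prime , m∣m*n (product as) , a≢p)
... | yes refl with product≡p^length⊎∃prime≢p p as-prime
...   | inj₁ eq = inj₁ (cong (a *_) eq)
...   | inj₂ (q , q-prime , q∣as , q≢p) = inj₂ (q , q-prime , ∣n⇒∣m*n a q∣as , q≢p)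

¬primePower⇒twoPrimes : ∀ {n} .{{_ : NonZero n}} → ¬ IsPrimePower n →
  ∃₂ λ p q → Prime p × Prime q × p ≢ q × p ∣ n × q ∣ n
¬primePower⇒twoPrimes {n} n-notPP with factorise n
... | record { factors = [] ; isFactorisation = n≡1 } =
  ⊥-elim (n-notPP (2 , 0 , prime[2] , n≡1))
... | record { factors = p ∷ ps ; isFactorisation = n≡p*ps
             ; factorsPrime = p-prime ∷ ps-prime }
  with product≡p^length⊎∃prime≢p p ps-prime
...   | inj₁ ps≡p^l =
  ⊥-elim (n-notPP (p , suc (length ps) , p-prime , trans n≡p*ps (cong (p *_) ps≡p^l)))
...   | inj₂ (q , q-prime , q∣ps , q≢p) =
  p , q , p-prime , q-prime , q≢p ∘ sym ,
  subst (p ∣_) (sym n≡p*ps) (m∣m*n (product ps)) ,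
  subst (q ∣_) (sym n≡p*ps) (∣n⇒∣m*n p q∣ps)

maximalPower∣ : ∀ {t} → 1 < t → ∀ d .{{_ : NonZero d}} →
  ∃ λ k → t ^ k ∣ d × ¬ t ^ suc k ∣ d
maximalPower∣ {t} 1<t d = go d (<-wellFounded d)
  where
  t≢0 : NonZero t
  t≢0 = >-nonZero (<-trans z<s 1<t)
  go : ∀ d .{{_ : NonZero d}} → Acc _<_ d → ∃ λ k → t ^ k ∣ d × ¬ t ^ suc k ∣ d
  go d (acc rec) with t ∣? d
  ... | no t∤d = 0 , 1∣ d , t∤d ∘ subst (_∣ d) (*-identityʳ t)
  ... | yes (divides d′ refl) =
    let k , t^k∣d′ , t^[1+k]∤d′ = go d′ {{d′≢0}} (rec (m<m*n d′ t {{d′≢0}} 1<t))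
    in suc k ,
       subst (t ^ suc k ∣_) (*-comm t d′) (*-monoʳ-∣ t t^k∣d′) ,
       t^[1+k]∤d′ ∘ *-cancelˡ-∣ t {{t≢0}} ∘ subst (t ^ suc (suc k) ∣_) (*-comm d′ t)
    where
    d′≢0 : NonZero d′
    d′≢0 = m*n≢0⇒m≢0 d′

∃primePower∣n∤d : ∀ {n d} .{{_ : NonZero n}} → d ∣ n → d ≢ n →
  ∃₂ λ t k → Prime t × t ^ suc k ∣ n × ¬ t ^ suc k ∣ d
∃primePower∣n∤d {n} {d} (divides m n≡m*d) d≢n =
  let t , t-prime , t∣m = ∃prime∣ m {{m≢0}} m≢1
      1<t = nonTrivial⇒n>1 t {{prime⇒nonTrivial t-prime}}
      k , t^k∣d , t^[1+k]∤d = maximalPower∣ 1<t d {{d≢0}}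
  in t , k , t-prime , subst (t ^ suc k ∣_) (sym n≡m*d) (*-pres-∣ t∣m t^k∣d) , t^[1+k]∤d
  where
  m≢1 : m ≢ 1
  m≢1 refl = d≢n (sym (trans n≡m*d (*-identityˡ d)))
  m≢0 : NonZero m
  m≢0 = m*n≢0⇒m≢0 m {{subst NonZero n≡m*d it}}
  d≢0 : NonZero d
  d≢0 = m*n≢0⇒n≢0 m {{subst NonZero n≡m*d it}}

-- Divisors incomparable under divisibility

infix 4 _∥_ _∥[_]_

_∥_ : ℕ → ℕ → Set
u ∥ v = ¬ u ∣ v × ¬ v ∣ u

_∥[_]_ : ℕ → ℕ → ℕ → Set
u ∥[ n ] v = u ∣ n × v ∣ n × u ∥ v

∥⇒≢1 : ∀ {u v} → u ∥ v → u ≢ 1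
∥⇒≢1 {v = v} (u∤v , _) refl = u∤v (1∣ v)

∣p^r⇒¬∥ : ∀ {p r u v} → Prime p → u ∣ p ^ r → v ∣ p ^ r → ¬ u ∥ v
∣p^r⇒¬∥ {p} {r} p-prime u∣p^r v∣p^r (u∤v , v∤u)
  with ∣p^r⇒≡p^k p-prime r u∣p^r | ∣p^r⇒≡p^k p-prime r v∣p^r
... | j , refl | k , refl with ≤-total j k
...   | inj₁ j≤k = u∤v (^-monoʳ-∣ p j≤k)
...   | inj₂ k≤j = v∤u (^-monoʳ-∣ p k≤j)

prime∥prime : ∀ {p q} → Prime p → Prime q → p ≢ q → p ∥ q
prime∥prime p-prime q-prime p≢q =
  p≢q ∘ prime∣prime⇒≡ p-prime q-prime , p≢q ∘ sym ∘ prime∣prime⇒≡ q-prime p-prime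

∥prime : ∀ {d p} → Prime p → d ≢ 1 → ¬ p ∣ d → d ∥ p
∥prime {d} {p} p-prime d≢1 p∤d = d∤p , p∤d
  where
  d∤p : ¬ d ∣ p
  d∤p d∣p with prime⇒irreducible p-prime d∣p
  ... | inj₁ d≡1  = d≢1 d≡1
  ... | inj₂ refl = p∤d ∣-refl

primePower∥prime : ∀ {t p} k → Prime t → Prime p → t ≢ p → t ^ suc k ∥ p
primePower∥prime {t} k t-prime p-prime t≢p =
  (λ t^[1+k]∣p → t≢p (prime∣prime⇒≡ t-prime p-prime (∣-trans (m∣m*n (t ^ k)) t^[1+k]∣p))) ,
  t≢p ∘ sym ∘ prime∣^⇒≡ p-prime t-prime (suc k)

module _ {n p q} .{{_ : NonZero n}} (p-prime : Prime p) (q-prime : Prime q)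
         (p≢q : p ≢ q) (p∣n : p ∣ n) (q∣n : q ∣ n) where

  q∥[n]p : q ∥[ n ] p
  q∥[n]p = q∣n , p∣n , prime∥prime q-prime p-prime (p≢q ∘ sym)

  primePower⇝p : ∀ {t} k → Prime t → t ^ suc k ∣ n → Star _∥[ n ]_ (t ^ suc k) p
  primePower⇝p {t} k t-prime t^[1+k]∣n with t ≟ p
  ... | no t≢p  = (t^[1+k]∣n , p∣n , primePower∥prime k t-prime p-prime t≢p) ◅ ε
  ... | yes refl = (t^[1+k]∣n , q∣n , primePower∥prime k t-prime q-prime p≢q) ◅ q∥[n]p ◅ ε

  pq∣⇒∤primePower : ∀ {d t} k → Prime t → p ∣ d → q ∣ d → ¬ d ∣ t ^ k
  pq∣⇒∤primePower k t-prime p∣d q∣d d∣t^k =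
    p≢q (trans (prime∣^⇒≡ p-prime t-prime k (∣-trans p∣d d∣t^k))
               (sym (prime∣^⇒≡ q-prime t-prime k (∣-trans q∣d d∣t^k))))

  ∥[n]-neighbour⇝p : ∀ {d e} → d ∥[ n ] e → ∃ λ w → d ∥[ n ] w × Star _∥[ n ]_ w p
  ∥[n]-neighbour⇝p {d} (d∣n , e∣n , d∥e@(_ , e∤d)) with p ∣? d | q ∣? d
  ... | no p∤d | _     = p , (d∣n , p∣n , ∥prime p-prime (∥⇒≢1 d∥e) p∤d) , ε
  ... | yes _ | no q∤d = q , (d∣n , q∣n , ∥prime q-prime (∥⇒≢1 d∥e) q∤d) , q∥[n]p ◅ ε
  ... | yes p∣d | yes q∣d =
    let t , k , t-prime , t^[1+k]∣n , t^[1+k]∤d = ∃primePower∣n∤d d∣n λ { refl → e∤d e∣n }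
        d∤t^[1+k] = pq∣⇒∤primePower (suc k) t-prime p∣d q∣d
    in t ^ suc k , (d∣n , t^[1+k]∣n , d∤t^[1+k] , t^[1+k]∤d) ,
       primePower⇝p k t-prime t^[1+k]∣n

-- The dihedral group: rotations, subgroups and the difference graph

module _ {n : ℕ} .{{_ : NonZero n}} where

  toℕ-mod : ∀ x → toℕ (x mod n) ≡ x % n
  toℕ-mod x = toℕ-fromℕ< (m%n<n x n)

  toℕ-0mod : toℕ (0 mod n) ≡ 0
  toℕ-0mod = trans (toℕ-mod 0) (m<n⇒m%n≡m (>-nonZero⁻¹ n))

  mod-cong : ∀ {x y} → x % n ≡ y % n → x mod n ≡ y mod n
  mod-cong {x} {y} eq = toℕ-injective (trans (toℕ-mod x) (trans eq (sym (toℕ-mod y))))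

  toℕ-mod-inverse : ∀ (i : Fin n) → toℕ i mod n ≡ i
  toℕ-mod-inverse i = toℕ-injective (trans (toℕ-mod (toℕ i)) (m<n⇒m%n≡m (toℕ<n i)))

  0⊕i≡i : ∀ i → (0 mod n) ⊕ i ≡ i
  0⊕i≡i i = trans (cong (λ z → (z + toℕ i) mod n) toℕ-0mod) (toℕ-mod-inverse i)

  i⊖0≡i : ∀ i → i ⊖ (0 mod n) ≡ i
  i⊖0≡i i = begin
    (toℕ i + (n ∸ toℕ (0 mod n))) mod n ≡⟨ cong (λ z → (toℕ i + (n ∸ z)) mod n) toℕ-0mod ⟩
    (toℕ i + n) mod n                   ≡⟨ mod-cong ([m+n]%n≡m%n (toℕ i) n) ⟩
    toℕ i mod n                         ≡⟨ toℕ-mod-inverse i ⟩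
    i                                   ∎
    where open ≡-Reasoning

  i⊖i≡0 : ∀ i → i ⊖ i ≡ 0 mod n
  i⊖i≡0 i = trans (cong (_mod n) (m+[n∸m]≡n (<⇒≤ (toℕ<n i))))
                  (mod-cong (trans (n%n≡0 n) (sym (m<n⇒m%n≡m (>-nonZero⁻¹ n)))))

  infix 25 r^_

  r^_ : ℕ → Dih n
  r^ x = rot (x mod n)

  r^-cong : ∀ {x y} → x % n ≡ y % n → r^ x ≡ r^ y
  r^-cong = cong rot ∘ mod-cong

  rot≡r^toℕ : ∀ i → rot i ≡ r^ toℕ i
  rot≡r^toℕ i = cong rot (sym (toℕ-mod-inverse i))

  r^-· : ∀ x y → r^ x · r^ y ≡ r^ (x + y)
  r^-· x y = r^-cong (trans (cong₂ (λ a b → (a + b) % n) (toℕ-mod x) (toℕ-mod y))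
                            (sym (%-distribˡ-+ x y n)))

  r^-inv : ∀ x → inv (r^ x) ≡ r^ (n ∸ x % n)
  r^-inv x = r^-cong (cong (_% n) (cong₂ (λ a b → a + (n ∸ b)) toℕ-0mod (toℕ-mod x)))

  r^n≡e : r^ n ≡ e
  r^n≡e = r^-cong (trans (n%n≡0 n) (sym (m<n⇒m%n≡m (>-nonZero⁻¹ n))))

  n∣m+[n∸m%n] : ∀ m → n ∣ m + (n ∸ m % n)
  n∣m+[n∸m%n] m = divides (suc (m / n)) (begin
    m + (n ∸ m % n)                   ≡⟨ cong (_+ (n ∸ m % n)) (m≡m%n+[m/n]*n m n) ⟩
    m % n + m / n * n + (n ∸ m % n)   ≡⟨ cong (_+ (n ∸ m % n)) (+-comm (m % n) (m / n * n)) ⟩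
    m / n * n + m % n + (n ∸ m % n)   ≡⟨ +-assoc (m / n * n) (m % n) (n ∸ m % n) ⟩
    m / n * n + (m % n + (n ∸ m % n)) ≡⟨ cong (m / n * n +_) (m+[n∸m]≡n (m%n≤n m n)) ⟩
    m / n * n + n                     ≡⟨ +-comm (m / n * n) n ⟩
    suc (m / n) * n                   ∎)
    where open ≡-Reasoning

  r^-cancelʳ : ∀ u v → r^ (u + v) · inv (r^ v) ≡ r^ u
  r^-cancelʳ u v = begin
    r^ (u + v) · inv (r^ v)          ≡⟨ cong (r^ (u + v) ·_) (r^-inv v) ⟩
    r^ (u + v) · r^ (n ∸ v % n)      ≡⟨ r^-· (u + v) (n ∸ v % n) ⟩
    r^ (u + v + (n ∸ v % n))         ≡⟨ cong r^_ (+-assoc u v (n ∸ v % n)) ⟩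
    r^ (u + (v + (n ∸ v % n)))       ≡⟨ r^-cong (%-remove-+ʳ u (n∣m+[n∸m%n] v)) ⟩
    r^ u                             ∎
    where open ≡-Reasoning

  record IsSubgroup (T : Pred (Dih n) 0ℓ) : Set where
    field
      e∈         : T e
      ·-closed   : ∀ {x y} → T x → T y → T (x · y)
      inv-closed : ∀ {x} → T x → T (inv x)

  ⟨⟩-least : ∀ {S T} → IsSubgroup T → S ⊆ T → ⟨ S ⟩ ⊆ T
  ⟨⟩-least T-sub S⊆T (gen x∈S)    = S⊆T x∈S
  ⟨⟩-least T-sub S⊆T unit         = IsSubgroup.e∈ T-sub
  ⟨⟩-least T-sub S⊆T (mul x∈ y∈)  =
    IsSubgroup.·-closed T-sub (⟨⟩-least T-sub S⊆T x∈) (⟨⟩-least T-sub S⊆T y∈)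
  ⟨⟩-least T-sub S⊆T (inverse x∈) = IsSubgroup.inv-closed T-sub (⟨⟩-least T-sub S⊆T x∈)

  ⟨⟩-isSubgroup : ∀ {S} → IsSubgroup ⟨ S ⟩
  ⟨⟩-isSubgroup = record { e∈ = unit ; ·-closed = mul ; inv-closed = inverse }

  ⟨,⟩₂-comm : ∀ {x y} → ⟨ x , y ⟩₂ ⊆ ⟨ y , x ⟩₂
  ⟨,⟩₂-comm = ⟨⟩-least ⟨⟩-isSubgroup λ { (inj₁ z≡x) → gen (inj₂ z≡x)
                                       ; (inj₂ z≡y) → gen (inj₁ z≡y) }

  RotDivisibleBy : ℕ → Pred (Dih n) 0ℓ
  RotDivisibleBy m z = ∃ λ c → z ≡ rot c × m ∣ toℕ c

  ∣toℕ-mod : ∀ {m} x → m ∣ n → m ∣ x → m ∣ toℕ (x mod n)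
  ∣toℕ-mod {m} x m∣n m∣x = subst (m ∣_) (sym (toℕ-mod x)) (%-presˡ-∣ m∣x m∣n)

  RotDivisibleBy-isSubgroup : ∀ {m} → m ∣ n → IsSubgroup (RotDivisibleBy m)
  RotDivisibleBy-isSubgroup {m} m∣n = record
    { e∈         = 0 mod n , refl , subst (m ∣_) (sym toℕ-0mod) (m ∣0)
    ; ·-closed   = λ { (c , refl , m∣c) (c′ , refl , m∣c′) →
                       c ⊕ c′ , refl , ∣toℕ-mod _ m∣n (∣m∣n⇒∣m+n m∣c m∣c′) }
    ; inv-closed = λ { (c , refl , m∣c) →
                       (0 mod n) ⊖ c , refl ,
                       ∣toℕ-mod _ m∣n (∣m∣n⇒∣m+n (∣toℕ-mod 0 m∣n (m ∣0)) (m∣n∸c c m∣c)) }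
    }
    where
    m∣n∸c : ∀ (c : Fin n) → m ∣ toℕ c → m ∣ n ∸ toℕ c
    m∣n∸c c m∣c = ∣m+n∣m⇒∣n (subst (m ∣_) (sym (m+[n∸m]≡n (<⇒≤ (toℕ<n c)))) m∣n) m∣c

  ReflPair : Fin n → Pred (Dih n) 0ℓ
  ReflPair k z = z ≡ e ⊎ z ≡ ref k

  ReflPair-isSubgroup : ∀ k → IsSubgroup (ReflPair k)
  ReflPair-isSubgroup k = record
    { e∈         = inj₁ refl
    ; ·-closed   = λ { (inj₁ refl) (inj₁ refl) → inj₁ (cong rot (0⊕i≡i _))
                     ; (inj₁ refl) (inj₂ refl) → inj₂ (cong ref (0⊕i≡i k))
                     ; (inj₂ refl) (inj₁ refl) → inj₂ (cong ref (i⊖0≡i k))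
                     ; (inj₂ refl) (inj₂ refl) → inj₁ (cong rot (i⊖i≡0 k)) }
    ; inv-closed = λ { (inj₁ refl) → inj₁ (cong rot (i⊖i≡0 (0 mod n)))
                     ; (inj₂ refl) → inj₂ refl }
    }

  module _ {S : Pred (Dih n) 0ℓ} where

    r^-∈-* : ∀ {x} → ⟨ S ⟩ (r^ x) → ∀ k → ⟨ S ⟩ (r^ (k * x))
    r^-∈-* x∈ zero    = unit
    r^-∈-* {x} x∈ (suc k) = subst ⟨ S ⟩ (r^-· x (k * x)) (mul x∈ (r^-∈-* x∈ k))

    r^-∈-cancelʳ : ∀ u v → ⟨ S ⟩ (r^ (u + v)) → ⟨ S ⟩ (r^ v) → ⟨ S ⟩ (r^ u)
    r^-∈-cancelʳ u v u+v∈ v∈ = subst ⟨ S ⟩ (r^-cancelʳ u v) (mul u+v∈ (inverse v∈))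

    r^-∈-gcd : ∀ x y → ⟨ S ⟩ (r^ x) → ⟨ S ⟩ (r^ y) → ⟨ S ⟩ (r^ gcd x y)
    r^-∈-gcd x y x∈ y∈ with Bézout.identity (gcd-GCD x y)
    ... | Bézout.+- a b g+by≡ax =
      r^-∈-cancelʳ (gcd x y) (b * y)
        (subst (⟨ S ⟩ ∘ r^_) (sym g+by≡ax) (r^-∈-* x∈ a)) (r^-∈-* y∈ b)
    ... | Bézout.-+ a b g+ax≡by =
      r^-∈-cancelʳ (gcd x y) (a * x)
        (subst (⟨ S ⟩ ∘ r^_) (sym g+ax≡by) (r^-∈-* y∈ b)) (r^-∈-* x∈ a)

    r^n∈ : ⟨ S ⟩ (r^ n)
    r^n∈ = subst ⟨ S ⟩ (sym r^n≡e) unit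

    rot∈⇒r^∈ : ∀ {c} → ⟨ S ⟩ (rot c) → ⟨ S ⟩ (r^ toℕ c)
    rot∈⇒r^∈ {c} = subst ⟨ S ⟩ (rot≡r^toℕ c)

    r^∈⇒rot-multiple∈ : ∀ {m c} → ⟨ S ⟩ (r^ m) → m ∣ toℕ c → ⟨ S ⟩ (rot c)
    r^∈⇒rot-multiple∈ {c = c} m∈ (divides k c≡km) =
      subst ⟨ S ⟩ (sym (trans (rot≡r^toℕ c) (cong r^_ c≡km))) (r^-∈-* m∈ k)

  δ : Fin n → ℕ
  δ a = gcd (toℕ a) n

  δ∣n : ∀ a → δ a ∣ n
  δ∣n a = gcd[m,n]∣n (toℕ a) n

  δ-mod : ∀ {u} → u ∣ n → δ (u mod n) ≡ u
  δ-mod {u} u∣n rewrite toℕ-mod u =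
    ∣-antisym (∣n∣m%n⇒∣m (gcd[m,n]∣n (u % n) n) (gcd[m,n]∣m (u % n) n))
              (gcd-greatest (%-presˡ-∣ ∣-refl u∣n) u∣n)

  ⟨rot⟩₁⊆RotDivisibleBy-δ : ∀ a → ⟨ rot a ⟩₁ ⊆ RotDivisibleBy (δ a)
  ⟨rot⟩₁⊆RotDivisibleBy-δ a =
    ⟨⟩-least (RotDivisibleBy-isSubgroup (δ∣n a)) λ { refl → a , refl , gcd[m,n]∣m (toℕ a) n }

  ∈⟨rot⟩⇒δ∣δ : ∀ {a b} → ⟨ rot a ⟩₁ (rot b) → δ a ∣ δ b
  ∈⟨rot⟩⇒δ∣δ {a} {b} b∈ with ⟨rot⟩₁⊆RotDivisibleBy-δ a b∈
  ... | .b , refl , δa∣b = gcd-greatest δa∣b (δ∣n a)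

  δ∣δ⇒∈⟨rot⟩ : ∀ {a b} → δ a ∣ δ b → ⟨ rot a ⟩₁ (rot b)
  δ∣δ⇒∈⟨rot⟩ {a} {b} δa∣δb =
    r^∈⇒rot-multiple∈ (r^-∈-gcd (toℕ a) n (rot∈⇒r^∈ (gen refl)) r^n∈)
                       (∣-trans δa∣δb (gcd[m,n]∣m (toℕ b) n))

  ⟨rot,rot⟩₂-cyclic : ∀ a b → IsCyclic ⟨ rot a , rot b ⟩₂
  ⟨rot,rot⟩₂-cyclic a b = r^ g , g∈ , λ z z∈ → generated z∈
    where
    a∧b = gcd (toℕ a) (toℕ b)
    g = gcd a∧b n
    g∈ : ⟨ rot a , rot b ⟩₂ (r^ g)
    g∈ = r^-∈-gcd a∧b n
           (r^-∈-gcd (toℕ a) (toℕ b) (rot∈⇒r^∈ (gen (inj₁ refl))) (rot∈⇒r^∈ (gen (inj₂ refl))))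
           r^n∈
    generators : (λ z → z ≡ rot a ⊎ z ≡ rot b) ⊆ RotDivisibleBy g
    generators (inj₁ refl) = a , refl , ∣-trans (gcd[m,n]∣m a∧b n) (gcd[m,n]∣m (toℕ a) (toℕ b))
    generators (inj₂ refl) = b , refl , ∣-trans (gcd[m,n]∣m a∧b n) (gcd[m,n]∣n (toℕ a) (toℕ b))
    generated : ⟨ rot a , rot b ⟩₂ ⊆ ⟨ r^ g ⟩₁
    generated z∈ with ⟨⟩-least (RotDivisibleBy-isSubgroup (gcd[m,n]∣n a∧b n)) generators z∈
    ... | c , refl , g∣c = r^∈⇒rot-multiple∈ {m = g} (gen refl) g∣c

  DiffAdj⇒δ∥ : ∀ {a b} → DiffAdj (rot a) (rot b) → δ a ∥ δ b
  DiffAdj⇒δ∥ (_ , a∉⟨b⟩ , b∉⟨a⟩) = b∉⟨a⟩ ∘ δ∣δ⇒∈⟨rot⟩ , a∉⟨b⟩ ∘ δ∣δ⇒∈⟨rot⟩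

  δ∥⇒DiffAdj : ∀ {a b} → δ a ∥ δ b → DiffAdj (rot a) (rot b)
  δ∥⇒DiffAdj {a} {b} (δa∤δb , δb∤δa) =
    ⟨rot,rot⟩₂-cyclic a b , δb∤δa ∘ ∈⟨rot⟩⇒δ∣δ , δa∤δb ∘ ∈⟨rot⟩⇒δ∣δ

  ∥[n]⇒DiffAdj : ∀ {u v} → u ∥[ n ] v → DiffAdj (r^ u) (r^ v)
  ∥[n]⇒DiffAdj (u∣n , v∣n , u∥v) =
    δ∥⇒DiffAdj (subst₂ _∥_ (sym (δ-mod u∣n)) (sym (δ-mod v∣n)) u∥v)

  DiffAdj-sym : ∀ {x y} → DiffAdj x y → DiffAdj y x
  DiffAdj-sym ((c , c∈ , generates) , x∉⟨y⟩ , y∉⟨x⟩) =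
    (c , ⟨,⟩₂-comm c∈ , λ z → generates z ∘ ⟨,⟩₂-comm) , y∉⟨x⟩ , x∉⟨y⟩

  ∈⟨⟩₁⇒ref-generator : ∀ {c k} → ⟨ c ⟩₁ (ref k) → c ≡ ref k
  ∈⟨⟩₁⇒ref-generator {rot a} ref∈ with ⟨rot⟩₁⊆RotDivisibleBy-δ a ref∈
  ... | _ , () , _
  ∈⟨⟩₁⇒ref-generator {ref j} ref∈ with ⟨⟩-least (ReflPair-isSubgroup j) inj₂ ref∈
  ... | inj₂ refl = refl

  ¬DiffAdj-refˡ : ∀ {k y} → ¬ DiffAdj (ref k) y
  ¬DiffAdj-refˡ {y = y} ((c , _ , generates) , _ , y∉⟨ref⟩)
    with ∈⟨⟩₁⇒ref-generator (generates _ (gen (inj₁ refl)))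
  ... | refl = y∉⟨ref⟩ (generates y (gen (inj₂ refl)))

  DiffAdj⇒rotations : ∀ {x y} → DiffAdj x y → (∃ λ a → x ≡ rot a) × (∃ λ b → y ≡ rot b)
  DiffAdj⇒rotations {rot a} {rot b} _   = (a , refl) , (b , refl)
  DiffAdj⇒rotations {ref _} adj         = ⊥-elim (¬DiffAdj-refˡ adj)
  DiffAdj⇒rotations {rot _} {ref _} adj = ⊥-elim (¬DiffAdj-refˡ (DiffAdj-sym adj))

  DiffVertex⇒δ∥δ : ∀ {x} → DiffVertex x → ∃₂ λ a b → x ≡ rot a × δ a ∥ δ b
  DiffVertex⇒δ∥δ (y , adj) with DiffAdj⇒rotations adj
  ... | (a , refl) , (b , refl) = a , b , refl , DiffAdj⇒δ∥ adj

  module _ {p q} (p-prime : Prime p) (q-prime : Prime q) (p≢q : p ≢ q)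
           (p∣n : p ∣ n) (q∣n : q ∣ n) where

    DiffVertex⇝r^p : ∀ {x} → DiffVertex x → Star DiffAdj x (r^ p)
    DiffVertex⇝r^p x-vertex with DiffVertex⇒δ∥δ x-vertex
    ... | a , b , refl , δa∥δb
      with ∥[n]-neighbour⇝p p-prime q-prime p≢q p∣n q∣n (δ∣n a , δ∣n b , δa∥δb)
    ... | w , (_ , w∣n , δa∥w) , w⇝p =
      δ∥⇒DiffAdj (subst (δ a ∥_) (sym (δ-mod w∣n)) δa∥w) ◅ gmap r^_ ∥[n]⇒DiffAdj w⇝p

    DiffConnected-twoPrimes : DiffConnected {n}
    DiffConnected-twoPrimes =
      (r^ p , r^ q , ∥[n]⇒DiffAdj (p∣n , q∣n , prime∥prime p-prime q-prime p≢q)) ,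
      λ x y x-vertex y-vertex →
        DiffVertex⇝r^p x-vertex ◅◅ reverse DiffAdj-sym (DiffVertex⇝r^p y-vertex)

  primePower⇒DiffEmpty : IsPrimePower n → DiffEmpty {n}
  primePower⇒DiffEmpty (p , r , p-prime , n≡p^r) x x-vertex =
    let a , b , _ , δa∥δb = DiffVertex⇒δ∥δ x-vertex
        δ∣p^r = λ c → subst (δ c ∣_) n≡p^r (δ∣n c)
    in ∣p^r⇒¬∥ {r = r} p-prime (δ∣p^r a) (δ∣p^r b) δa∥δb

  ¬primePower⇒DiffConnected : ¬ IsPrimePower n → DiffConnected {n}
  ¬primePower⇒DiffConnected n-notPP =
    let p , q , p-prime , q-prime , p≢q , p∣n , q∣n = ¬primePower⇒twoPrimes n-notPP
    in DiffConnected-twoPrimes p-prime q-prime p≢q p∣n q∣n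

theorem3p5 : (n : ℕ) .{{_ : NonZero n}} →
    (IsPrimePower n → DiffEmpty {n}) × (¬ IsPrimePower n → DiffConnected {n})
theorem3p5 n = primePower⇒DiffEmpty , ¬primePower⇒DiffConnected
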